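{- Let $\pi\in\mathcal{OP}(n,d,r)$, let $U\in\mathcal{J}_r(\pi)$, and let $T$ be any array obtained from $U$ by permuting the entries within columns (i.e. $T\in\overline{\mathcal{J}}_r(U)$). Then $\mathrm{sgn}(U)=\mathrm{sgn}(T)$.
   Context: An ordered set partition of $[n]$ with $d$ blocks is a sequence $\pi=(\pi_1\mid\cdots\mid\pi_d)$ of nonempty pairwise disjoint subsets of $[n]$ with union $[n]$; $\mathcal{OP}(n,d,r)$ is the set of those with every block of size at least $r$. An $r$-jellyfish tableau for $\pi$ is an array with $n-(d-1)r$ rows and $d$ columns, cells empty or containing elements of $[n]$, such that all cells in rows $1,\dots,r$ are nonempty, each row $i>r$ has exactly one nonempty cell, and the nonempty entries of column $j$ are exactly $\pi_j$, increasing downward; $\mathcal{J}_r(\pi)$ is their set. $\overline{\mathcal{J}}_r(U)$ is the set of arrays obtained from $U\in\mathcal{J}_r(\pi)$ by permuting entries within columns (keeping the set of nonempty cells). For any such array $T$, $\mathrm{inv}(T)$ is the number of pairs of entries lying in different columns that appear in decreasing order in the row reading word (rows left to right, top to bottom, empty cells skipped); inversions between entries of the same column are not counted. $\mathrm{sgn}(T)=(-1)^{\mathrm{inv}(T)}$. (For $U\in\mathcal{J}_r(\pi)$ this agrees with the number of all inversions of its reading word, since columns are increasing.) -}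

module Defs where

open import Data.Nat using (ℕ; zero; suc; _+_; _*_; _∸_; _≤_; _<_)
open import Data.Bool using (Bool; true; false; if_then_else_)
open import Data.Fin using (Fin; toℕ) renaming (_<_ to _<ᶠ_)
import Data.Fin as F
open import Data.Fin.Subset using (Subset; _∈_; _∩_; ∣_∣; Nonempty; Empty)
open import Data.Fin.Permutation using (Permutation′; _⟨$⟩ʳ_)
open import Data.Maybe using (Maybe; just; nothing; is-just; maybe)
open import Data.List using (List; []; _∷_; [_]; concatMap; allFin)
open import Data.Product using (Σ; ∃; _×_; _,_)
open import Data.Integer using (ℤ; -1ℤ) renaming (_^_ to _^ℤ_)
open import Relation.Binary.PropositionalEquality using (_≡_; _≢_)
open import Relation.Nullary using (¬_; does)
open import Function using (_⇔_)

record OrderedSetPartition (n d : ℕ) : Set where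
  field
    block    : Fin d → Subset n
    nonempty : ∀ j → Nonempty (block j)
    disjoint : ∀ j k → j ≢ k → Empty (block j ∩ block k)
    cover    : ∀ x → ∃ λ j → x ∈ block j
open OrderedSetPartition public

InOP : ∀ {n d} → ℕ → OrderedSetPartition n d → Set
InOP r π = ∀ j → r ≤ ∣ block π j ∣

-- Arrays: rows × d columns, each cell empty (nothing) or an element of [n].
-- Rows are 0-indexed, so "rows 1..r" are the rows i with toℕ i < r.

numRows : ℕ → ℕ → ℕ → ℕ
numRows n d r = n ∸ (d ∸ 1) * r

Array : ℕ → ℕ → ℕ → Set
Array m d n = Fin m → Fin d → Maybe (Fin n)

IsFilled : ∀ {n} → Maybe (Fin n) → Set
IsFilled c = is-just c ≡ true

record IsJellyfish {n d} (r : ℕ) (π : OrderedSetPartition n d)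
                   (U : Array (numRows n d r) d n) : Set where
  field
    topFull    : ∀ i j → toℕ i < r → IsFilled (U i j)
    tailSingle : ∀ i → r ≤ toℕ i →
                 ∃ λ j → IsFilled (U i j) × (∀ k → IsFilled (U i k) → k ≡ j)
    columns    : ∀ j x → (x ∈ block π j) ⇔ (∃ λ i → U i j ≡ just x)
    increasing : ∀ j i i' x y → i <ᶠ i' → U i j ≡ just x → U i' j ≡ just y →
                 x <ᶠ y

InClosure : ∀ {m d n} → Array m d n → Array m d n → Set
InClosure {m} {d} U T =
  (∀ i j → is-just (T i j) ≡ is-just (U i j)) ×
  Σ (Fin d → Permutation′ m) λ σ → ∀ i j → T i j ≡ U (σ j ⟨$⟩ʳ i) j

-- Row reading word (rows top to bottom, left to right, empty cells skipped),
-- each entry tagged by its column.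

readingWord : ∀ {m d n} → Array m d n → List (Fin d × Fin n)
readingWord {m} {d} T =
  concatMap (λ i → concatMap (λ j → maybe (λ x → [ (j , x) ]) [] (T i j))
                             (allFin d))
            (allFin m)

countBelow : ∀ {d n} → Fin d → Fin n → List (Fin d × Fin n) → ℕ
countBelow c x [] = 0
countBelow c x ((c' , y) ∷ w) =
  (if does (c F.≟ c') then 0 else (if does (y F.<? x) then 1 else 0))
  + countBelow c x w

invWord : ∀ {d n} → List (Fin d × Fin n) → ℕ
invWord [] = 0
invWord ((c , x) ∷ w) = countBelow c x w + invWord w

inv : ∀ {m d n} → Array m d n → ℕ
inv T = invWord (readingWord T)

sgn : ∀ {m d n} → Array m d n → ℤ
sgn T = -1ℤ ^ℤ inv T

{-# OPTIONS --safe #-}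
-- Write each entry of an array as a pair (column, value). For two entries
-- e = (c , x) before e' = (c' , y) in the reading word, with x ≢ y when
-- c ≢ c', one checks case by case that
--   [c ≢ c'][y < x] + [c' < c]  =  ([c < c'][y < x] + [c' < c][x < y])  +  2 [c' < c][y < x].
-- Summed over all pairs, the first term on the left is inv, the second
-- depends only on the sequence of columns of the reading word, and the first
-- term on the right, being symmetric in e and e', depends only on the
-- multiset of entries. Permuting entries within columns preserves both the
-- column sequence and the multiset of entries, so inv changes by an even
-- number.
module Submission where

open import Defs
open import Data.Nat using (ℕ; zero; suc; _+_; _*_)
open import Data.Nat.Properties
  using (+-0-commutativeMonoid; +-assoc; +-identityʳ; +-cancelʳ-≡; *-distribˡ-+)
open import Data.Nat.Solver using (module +-*-Solver)
open import Data.Integer using (-1ℤ; 1ℤ) renaming (_^_ to _^ℤ_; _*_ to _*ℤ_)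
open import Data.Integer.Properties using (^-distribˡ-+-*; ^-*-assoc; ^-zeroˡ; *-identityʳ)
open import Data.Bool using (if_then_else_)
open import Data.Fin using (Fin)
import Data.Fin as F
open import Data.Fin.Properties using (<-cmp; <-irrefl; <-asym)
open import Data.Fin.Subset using () renaming (_∈_ to _∈ˢ_)
open import Data.Fin.Subset.Properties using (x∈p∩q⁺)
open import Data.Fin.Permutation using (_⟨$⟩ʳ_)
open import Data.Maybe using (Maybe; just; nothing; is-just; maybe)
open import Data.List using (List; []; _∷_; [_]; _++_; map; concatMap; allFin; tabulate)
open import Data.List.Properties using (map-concatMap; concatMap-cong)
open import Data.List.Membership.Propositional using (_∈_)
open import Data.List.Membership.Propositional.Properties using (∈-concatMap⁻)
open import Data.List.Relation.Unary.Any using (here; there; satisfied)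
open import Data.Product using (∃; _×_; _,_; proj₁; proj₂)
open import Data.Empty using (⊥-elim)
open import Relation.Nullary using (Dec; does; yes; no)
open import Relation.Nullary.Decidable using (dec-true; dec-false)
open import Relation.Binary using (tri<; tri≈; tri>)
open import Relation.Binary.PropositionalEquality
  using (_≡_; refl; sym; trans; cong; cong₂; module ≡-Reasoning)
open import Function using (_∘_; Equivalence)
open import Algebra.Properties.CommutativeMonoid.Sum +-0-commutativeMonoid
  using (sum; sum-syntax; ∑-comm; sum-permute; sum-cong-≗)

open +-*-Solver

private variable
  A B : Set

sumBy : (A → ℕ) → List A → ℕ
sumBy f []       = 0
sumBy f (a ∷ xs) = f a + sumBy f xs

sumBy-++ : ∀ (f : A → ℕ) xs ys → sumBy f (xs ++ ys) ≡ sumBy f xs + sumBy f ys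
sumBy-++ f []       ys = refl
sumBy-++ f (a ∷ xs) ys = trans (cong (f a +_) (sumBy-++ f xs ys)) (sym (+-assoc (f a) _ _))

sumBy-cong : ∀ {f g : A → ℕ} xs → (∀ {a} → a ∈ xs → f a ≡ g a) → sumBy f xs ≡ sumBy g xs
sumBy-cong []       f≡g = refl
sumBy-cong (a ∷ xs) f≡g = cong₂ _+_ (f≡g (here refl)) (sumBy-cong xs (f≡g ∘ there))

sumBy-+ : ∀ (f g : A → ℕ) xs → sumBy (λ a → f a + g a) xs ≡ sumBy f xs + sumBy g xs
sumBy-+ f g []       = refl
sumBy-+ f g (a ∷ xs) rewrite sumBy-+ f g xs =
  solve 4 (λ p q r s → (p :+ q) :+ (r :+ s) := (p :+ r) :+ (q :+ s)) refl
    (f a) (g a) (sumBy f xs) (sumBy g xs)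

sumBy-scale : ∀ k (f : A → ℕ) xs → sumBy (λ a → k * f a) xs ≡ k * sumBy f xs
sumBy-scale k f []       = solve 1 (λ k → con 0 := k :* con 0) refl k
sumBy-scale k f (a ∷ xs) =
  trans (cong (k * f a +_) (sumBy-scale k f xs)) (sym (*-distribˡ-+ k (f a) _))

sumBy-map : ∀ (f : B → ℕ) (g : A → B) xs → sumBy f (map g xs) ≡ sumBy (f ∘ g) xs
sumBy-map f g []       = refl
sumBy-map f g (a ∷ xs) = cong (f (g a) +_) (sumBy-map f g xs)

sumBy-concatMap : ∀ (f : B → ℕ) (g : A → List B) xs →
                  sumBy f (concatMap g xs) ≡ sumBy (sumBy f ∘ g) xs
sumBy-concatMap f g []       = refl
sumBy-concatMap f g (a ∷ xs) =
  trans (sumBy-++ f (g a) (concatMap g xs)) (cong (sumBy f (g a) +_) (sumBy-concatMap f g xs))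

sumBy-tabulate : ∀ (f : A → ℕ) {m} (g : Fin m → A) → sumBy f (tabulate g) ≡ sum (f ∘ g)
sumBy-tabulate f {zero}  g = refl
sumBy-tabulate f {suc m} g = cong (f (g F.zero) +_) (sumBy-tabulate f (g ∘ F.suc))

pairSum : (A → A → ℕ) → List A → ℕ
pairSum f []       = 0
pairSum f (a ∷ xs) = sumBy (f a) xs + pairSum f xs

doubleSum : (A → A → ℕ) → List A → ℕ
doubleSum f xs = sumBy (λ a → sumBy (f a) xs) xs

pairSum-cong : ∀ {f g : A → A → ℕ} xs → (∀ {a b} → a ∈ xs → b ∈ xs → f a b ≡ g a b) →
               pairSum f xs ≡ pairSum g xs
pairSum-cong []       f≡g = refl
pairSum-cong (a ∷ xs) f≡g =
  cong₂ _+_ (sumBy-cong xs (f≡g (here refl) ∘ there))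
            (pairSum-cong xs (λ a∈ b∈ → f≡g (there a∈) (there b∈)))

pairSum-+ : ∀ (f g : A → A → ℕ) xs →
            pairSum (λ a b → f a b + g a b) xs ≡ pairSum f xs + pairSum g xs
pairSum-+ f g []       = refl
pairSum-+ f g (a ∷ xs) rewrite sumBy-+ (f a) (g a) xs | pairSum-+ f g xs =
  solve 4 (λ p q r s → (p :+ q) :+ (r :+ s) := (p :+ r) :+ (q :+ s)) refl
    (sumBy (f a) xs) (sumBy (g a) xs) (pairSum f xs) (pairSum g xs)

pairSum-scale : ∀ k (f : A → A → ℕ) xs → pairSum (λ a b → k * f a b) xs ≡ k * pairSum f xs
pairSum-scale k f []       = solve 1 (λ k → con 0 := k :* con 0) refl k
pairSum-scale k f (a ∷ xs) =
  trans (cong₂ _+_ (sumBy-scale k (f a) xs) (pairSum-scale k f xs))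
        (sym (*-distribˡ-+ k _ _))

pairSum-map : ∀ (f : B → B → ℕ) (g : A → B) xs →
              pairSum f (map g xs) ≡ pairSum (λ a b → f (g a) (g b)) xs
pairSum-map f g []       = refl
pairSum-map f g (a ∷ xs) = cong₂ _+_ (sumBy-map (f (g a)) g xs) (pairSum-map f g xs)

pairSum-symmetrize : ∀ (f : A → A → ℕ) → (∀ a → f a a ≡ 0) → ∀ xs →
                     pairSum (λ a b → f a b + f b a) xs ≡ doubleSum f xs
pairSum-symmetrize f diag []       = refl
pairSum-symmetrize f diag (a ∷ xs) = begin
  sumBy (λ b → f a b + f b a) xs + pairSum (λ a b → f a b + f b a) xs
    ≡⟨ cong₂ _+_ (sumBy-+ (f a) (λ b → f b a) xs) (pairSum-symmetrize f diag xs) ⟩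
  (sumBy (f a) xs + sumBy (λ b → f b a) xs) + doubleSum f xs
    ≡⟨ +-assoc (sumBy (f a) xs) _ _ ⟩
  sumBy (f a) xs + (sumBy (λ b → f b a) xs + doubleSum f xs)
    ≡⟨ cong₂ _+_ (cong (_+ sumBy (f a) xs) (sym (diag a)))
                 (sym (sumBy-+ (λ b → f b a) (λ b → sumBy (f b) xs) xs)) ⟩
  doubleSum f (a ∷ xs) ∎
  where open ≡-Reasoning

doubleSum-cong : ∀ (f : A → A → ℕ) {xs ys} → (∀ h → sumBy h xs ≡ sumBy h ys) →
                 doubleSum f xs ≡ doubleSum f ys
doubleSum-cong f {xs} {ys} same =
  trans (sumBy-cong xs (λ {a} _ → same (f a))) (same (λ a → sumBy (f a) ys))

χ : ∀ {P : Set} → Dec P → ℕ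
χ p = if does p then 1 else 0

columnInversion : ∀ {d} → Fin d → Fin d → ℕ
columnInversion c c' = χ (c' F.<? c)

module _ {d n : ℕ} where

  Entry : Set
  Entry = Fin d × Fin n

  crossInversion : Entry → Entry → ℕ
  crossInversion (c , x) (c' , y) = if does (c F.≟ c') then 0 else χ (y F.<? x)

  ascendingInversion : Entry → Entry → ℕ
  ascendingInversion (c , x) (c' , y) = if does (c F.<? c') then χ (y F.<? x) else 0

  descendingInversion : Entry → Entry → ℕ
  descendingInversion (c , x) (c' , y) = if does (c' F.<? c) then χ (y F.<? x) else 0

  ascendingInversion-diag : ∀ e → ascendingInversion e e ≡ 0
  ascendingInversion-diag (c , x) rewrite dec-false (c F.<? c) (<-irrefl refl) = refl

  invWord≡pairSum : ∀ (w : List Entry) → invWord w ≡ pairSum crossInversion w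
  invWord≡pairSum []            = refl
  invWord≡pairSum ((c , x) ∷ w) = cong₂ _+_ (countBelow≡sumBy w) (invWord≡pairSum w)
    where
    countBelow≡sumBy : ∀ v → countBelow c x v ≡ sumBy (crossInversion (c , x)) v
    countBelow≡sumBy []       = refl
    countBelow≡sumBy (_ ∷ v) = cong (_ +_) (countBelow≡sumBy v)

  crossInversion-decomposition :
    ∀ c c' x y → (x ≡ y → c ≡ c') →
    crossInversion (c , x) (c' , y) + columnInversion c c'
      ≡ (ascendingInversion (c , x) (c' , y) + ascendingInversion (c' , y) (c , x))
        + 2 * descendingInversion (c , x) (c' , y)
  crossInversion-decomposition c c' x y x≡y⇒c≡c' with <-cmp c c'
  ... | tri≈ _ refl _
    rewrite dec-true (c F.≟ c) refl | dec-false (c F.<? c) (<-irrefl refl) = refl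
  ... | tri< c<c' c≢c' _
    rewrite dec-false (c F.≟ c') c≢c' | dec-true (c F.<? c') c<c'
          | dec-false (c' F.<? c) (<-asym c<c') = sym (+-identityʳ _)
  ... | tri> _ c≢c' c'<c
    rewrite dec-false (c F.≟ c') c≢c' | dec-false (c F.<? c') (<-asym c'<c)
          | dec-true (c' F.<? c) c'<c with <-cmp x y
  ...   | tri≈ _ x≡y _ = ⊥-elim (c≢c' (x≡y⇒c≡c' x≡y))
  ...   | tri< x<y _ _
    rewrite dec-false (y F.<? x) (<-asym x<y) | dec-true (x F.<? y) x<y = refl
  ...   | tri> _ _ y<x
    rewrite dec-true (y F.<? x) y<x | dec-false (x F.<? y) (<-asym y<x) = refl

  ValuesDetermineColumns : List Entry → Set
  ValuesDetermineColumns w = ∀ {c c' x} → (c , x) ∈ w → (c' , x) ∈ w → c ≡ c'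

  invWord-decomposition :
    ∀ w → ValuesDetermineColumns w →
    invWord w + pairSum columnInversion (map proj₁ w)
      ≡ doubleSum ascendingInversion w + 2 * pairSum descendingInversion w
  invWord-decomposition w valuesDetermineColumns = begin
    invWord w + pairSum columnInversion (map proj₁ w)
      ≡⟨ cong₂ _+_ (invWord≡pairSum w) (pairSum-map columnInversion proj₁ w) ⟩
    pairSum crossInversion w + pairSum (λ e e' → columnInversion (proj₁ e) (proj₁ e')) w
      ≡⟨ sym (pairSum-+ crossInversion _ w) ⟩
    pairSum (λ e e' → crossInversion e e' + columnInversion (proj₁ e) (proj₁ e')) w
      ≡⟨ pairSum-cong w decomposition ⟩
    pairSum (λ e e' → ascending e e' + 2 * descendingInversion e e') w
      ≡⟨ pairSum-+ ascending _ w ⟩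
    pairSum ascending w + pairSum (λ e e' → 2 * descendingInversion e e') w
      ≡⟨ cong₂ _+_ (pairSum-symmetrize ascendingInversion ascendingInversion-diag w)
                   (pairSum-scale 2 descendingInversion w) ⟩
    doubleSum ascendingInversion w + 2 * pairSum descendingInversion w ∎
    where
    open ≡-Reasoning
    ascending : Entry → Entry → ℕ
    ascending e e' = ascendingInversion e e' + ascendingInversion e' e
    decomposition : ∀ {e e'} → e ∈ w → e' ∈ w →
                    crossInversion e e' + columnInversion (proj₁ e) (proj₁ e')
                      ≡ ascending e e' + 2 * descendingInversion e e'
    decomposition {c , x} {c' , y} e∈ e'∈ =
      crossInversion-decomposition c c' x y (λ { refl → valuesDetermineColumns e∈ e'∈ })

module _ {m d n : ℕ} where

  cellWord : Fin d → Maybe (Fin n) → List (Fin d × Fin n)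
  cellWord j = maybe (λ x → [ (j , x) ]) []

  ∈-readingWord⁻ : ∀ (T : Array m d n) {c x} → (c , x) ∈ readingWord T → ∃ λ i → T i c ≡ just x
  ∈-readingWord⁻ T c,x∈ with satisfied (∈-concatMap⁻ _ {xs = allFin m} c,x∈)
  ... | i , c,x∈row with satisfied (∈-concatMap⁻ (λ j → cellWord j (T i j)) {xs = allFin d} c,x∈row)
  ... | j , c,x∈cell = inCell (T i j) refl c,x∈cell
    where
    inCell : ∀ {c x} cell → T i j ≡ cell → (c , x) ∈ cellWord j cell → ∃ λ i' → T i' c ≡ just x
    inCell (just _) Tij≡ (here refl) = i , Tij≡

  sumBy-readingWord : ∀ (h : Fin d × Fin n → ℕ) (T : Array m d n) →
    sumBy h (readingWord T) ≡ ∑[ j < d ] ∑[ i < m ] sumBy h (cellWord j (T i j))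
  sumBy-readingWord h T = begin
    sumBy h (readingWord T)
      ≡⟨ sumBy-concatMap h _ (allFin m) ⟩
    sumBy (λ i → sumBy h (concatMap (λ j → cellWord j (T i j)) (allFin d))) (allFin m)
      ≡⟨ sumBy-cong (allFin m) (λ {i} _ →
           trans (sumBy-concatMap h _ (allFin d))
                 (sumBy-tabulate (λ j → sumBy h (cellWord j (T i j))) (λ j → j))) ⟩
    sumBy (λ i → ∑[ j < d ] sumBy h (cellWord j (T i j))) (allFin m)
      ≡⟨ sumBy-tabulate (λ i → ∑[ j < d ] sumBy h (cellWord j (T i j))) (λ i → i) ⟩
    ∑[ i < m ] ∑[ j < d ] sumBy h (cellWord j (T i j))
      ≡⟨ ∑-comm (λ i j → sumBy h (cellWord j (T i j))) ⟩
    ∑[ j < d ] ∑[ i < m ] sumBy h (cellWord j (T i j)) ∎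
    where open ≡-Reasoning

  sumBy-readingWord-closure : ∀ {U T : Array m d n} → InClosure U T → ∀ h →
                              sumBy h (readingWord T) ≡ sumBy h (readingWord U)
  sumBy-readingWord-closure {U} {T} (_ , σ , T≡Uσ) h = begin
    sumBy h (readingWord T)
      ≡⟨ sumBy-readingWord h T ⟩
    ∑[ j < d ] ∑[ i < m ] sumBy h (cellWord j (T i j))
      ≡⟨ sum-cong-≗ (λ j → trans (sum-cong-≗ (λ i → cong (sumBy h ∘ cellWord j) (T≡Uσ i j)))
                                 (sym (sum-permute (λ i → sumBy h (cellWord j (U i j))) (σ j)))) ⟩
    ∑[ j < d ] ∑[ i < m ] sumBy h (cellWord j (U i j))
      ≡⟨ sym (sumBy-readingWord h U) ⟩
    sumBy h (readingWord U) ∎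
    where open ≡-Reasoning

  columnWord : Array m d n → List (Fin d)
  columnWord T = map proj₁ (readingWord T)

  columnWord-shape : ∀ (T : Array m d n) → columnWord T ≡
    concatMap (λ i → concatMap (λ j → if is-just (T i j) then [ j ] else []) (allFin d)) (allFin m)
  columnWord-shape T =
    trans (map-concatMap proj₁ _ (allFin m))
          (concatMap-cong (λ i → trans (map-concatMap proj₁ _ (allFin d))
                                       (concatMap-cong (λ j → cellColumns j (T i j)) (allFin d)))
                          (allFin m))
    where
    cellColumns : ∀ j cell → map proj₁ (cellWord j cell) ≡ (if is-just cell then [ j ] else [])
    cellColumns j (just _) = refl
    cellColumns j nothing  = refl

  columnWord-closure : ∀ {U T : Array m d n} → InClosure U T → columnWord T ≡ columnWord U
  columnWord-closure {U} {T} (sameShape , _) =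
    trans (columnWord-shape T)
          (trans (concatMap-cong (λ i → concatMap-cong
                                   (λ j → cong (λ b → if b then [ j ] else []) (sameShape i j))
                                   (allFin d))
                                 (allFin m))
                 (sym (columnWord-shape U)))

-1^-+2* : ∀ a k → -1ℤ ^ℤ (a + 2 * k) ≡ -1ℤ ^ℤ a
-1^-+2* a k = begin
  -1ℤ ^ℤ (a + 2 * k)            ≡⟨ ^-distribˡ-+-* -1ℤ a (2 * k) ⟩
  -1ℤ ^ℤ a *ℤ -1ℤ ^ℤ (2 * k)    ≡⟨ cong (-1ℤ ^ℤ a *ℤ_) (sym (^-*-assoc -1ℤ 2 k)) ⟩
  -1ℤ ^ℤ a *ℤ 1ℤ ^ℤ k           ≡⟨ cong (-1ℤ ^ℤ a *ℤ_) (^-zeroˡ k) ⟩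
  -1ℤ ^ℤ a *ℤ 1ℤ                ≡⟨ *-identityʳ _ ⟩
  -1ℤ ^ℤ a                      ∎
  where open ≡-Reasoning

-1^-sameParity : ∀ a b c s k l → a + c ≡ s + 2 * k → b + c ≡ s + 2 * l →
                 -1ℤ ^ℤ a ≡ -1ℤ ^ℤ b
-1^-sameParity a b c s k l a+c≡ b+c≡ = begin
  -1ℤ ^ℤ a             ≡⟨ sym (-1^-+2* a l) ⟩
  -1ℤ ^ℤ (a + 2 * l)   ≡⟨ cong (-1ℤ ^ℤ_) (+-cancelʳ-≡ c _ _ shifted) ⟩
  -1ℤ ^ℤ (b + 2 * k)   ≡⟨ -1^-+2* b k ⟩
  -1ℤ ^ℤ b             ∎
  where
  open ≡-Reasoning
  shifted : a + 2 * l + c ≡ b + 2 * k + c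
  shifted = begin
    a + 2 * l + c         ≡⟨ solve 3 (λ a l c → a :+ con 2 :* l :+ c := (a :+ c) :+ con 2 :* l) refl a l c ⟩
    a + c + 2 * l         ≡⟨ cong (_+ 2 * l) a+c≡ ⟩
    s + 2 * k + 2 * l     ≡⟨ solve 3 (λ s k l → s :+ con 2 :* k :+ con 2 :* l := (s :+ con 2 :* l) :+ con 2 :* k) refl s k l ⟩
    s + 2 * l + 2 * k     ≡⟨ cong (_+ 2 * k) (sym b+c≡) ⟩
    b + c + 2 * k         ≡⟨ solve 3 (λ b c k → (b :+ c) :+ con 2 :* k := b :+ con 2 :* k :+ c) refl b c k ⟩
    b + 2 * k + c         ∎

module _ {m d n : ℕ} where

  ColumnsDisjoint : Array m d n → Set
  ColumnsDisjoint U = ∀ {i i' c c' x} → U i c ≡ just x → U i' c' ≡ just x → c ≡ c'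

  readingWord-valuesDetermineColumns :
    ∀ {U T : Array m d n} → (∀ {i c x} → T i c ≡ just x → ∃ λ i' → U i' c ≡ just x) →
    ColumnsDisjoint U → ValuesDetermineColumns (readingWord T)
  readingWord-valuesDetermineColumns {T = T} entryOfU disjointU c,x∈ c',x∈ =
    disjointU (proj₂ (entryOfU (proj₂ (∈-readingWord⁻ T c,x∈))))
              (proj₂ (entryOfU (proj₂ (∈-readingWord⁻ T c',x∈))))

  sgn-closure : ∀ {U T : Array m d n} → ColumnsDisjoint U → InClosure U T → sgn U ≡ sgn T
  sgn-closure {U} {T} disjointU U~T@(_ , σ , T≡Uσ) =
    -1^-sameParity (inv U) (inv T) columnInversions ascendingInversions
                   (descendingInversions U) (descendingInversions T) decompositionU decompositionT
    where
    open ≡-Reasoning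
    columnInversions    = pairSum columnInversion (columnWord U)
    ascendingInversions = doubleSum ascendingInversion (readingWord U)
    descendingInversions : Array m d n → ℕ
    descendingInversions W = pairSum descendingInversion (readingWord W)
    decompositionU : inv U + columnInversions ≡ ascendingInversions + 2 * descendingInversions U
    decompositionU = invWord-decomposition (readingWord U)
      (readingWord-valuesDetermineColumns {U = U} {T = U} (λ Uic≡ → _ , Uic≡) disjointU)
    decompositionT : inv T + columnInversions ≡ ascendingInversions + 2 * descendingInversions T
    decompositionT = begin
      inv T + pairSum columnInversion (columnWord U)
        ≡⟨ cong (λ w → inv T + pairSum columnInversion w) (sym (columnWord-closure U~T)) ⟩
      inv T + pairSum columnInversion (columnWord T)
        ≡⟨ invWord-decomposition (readingWord T)
             (readingWord-valuesDetermineColumns {U = U} {T = T} entryOfU disjointU) ⟩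
      doubleSum ascendingInversion (readingWord T) + 2 * descendingInversions T
        ≡⟨ cong (_+ _) (doubleSum-cong ascendingInversion {readingWord T} {readingWord U}
                                       (sumBy-readingWord-closure U~T)) ⟩
      ascendingInversions + 2 * descendingInversions T ∎
      where
      entryOfU : ∀ {i c x} → T i c ≡ just x → ∃ λ i' → U i' c ≡ just x
      entryOfU {i} {c} Tic≡ = σ c ⟨$⟩ʳ i , trans (sym (T≡Uσ i c)) Tic≡

jellyfish-columnsDisjoint : ∀ {n d r} {π : OrderedSetPartition n d}
                              {U : Array (numRows n d r) d n} →
                            IsJellyfish r π U → ColumnsDisjoint U
jellyfish-columnsDisjoint {π = π} {U} J {c = c} {c'} {x} Uic≡ Ui'c'≡ with c F.≟ c'
... | yes c≡c' = c≡c'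
... | no  c≢c' = ⊥-elim (disjoint π c c' c≢c' (x , x∈p∩q⁺ (inBlock Uic≡ , inBlock Ui'c'≡)))
  where
  inBlock : ∀ {i j} → U i j ≡ just x → x ∈ˢ block π j
  inBlock Uij≡ = Equivalence.from (IsJellyfish.columns J _ _) (_ , Uij≡)

lemma5p3 : (n d r : ℕ) (π : OrderedSetPartition n d) → InOP r π →
           (U : Array (numRows n d r) d n) → IsJellyfish r π U →
           (T : Array (numRows n d r) d n) → InClosure U T →
           sgn U ≡ sgn T
-- Neither the block sizes (InOP) nor the shape of U matters: only that the
-- columns of U hold disjoint sets of values.
lemma5p3 n d r π _ U J T U~T = sgn-closure (jellyfish-columnsDisjoint J) U~T
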